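{- If $M[x:=N]:\langle\Gamma\vdash U\rangle$, $x\notin FV(N)$ and $\mathcal U=FV((\lambda x.M)N)$, then $(\lambda x.M)N:\langle\Gamma{\uparrow^{\mathcal U}}\vdash U\rangle$.
   Context: Terms: $\mathcal V$ is a denumerably infinite set of variables; $\mathcal M$ is the set of untyped $\lambda$-terms $M::=x\mid \lambda x.M\mid MM$ taken modulo $\alpha$-conversion; $FV(M)$ is the set of free variables; $M[x:=N]$ is capture-avoiding substitution. Types: $\mathcal A$ is a denumerably infinite set of atomic types; $\mathbb T::=a\mid \mathbb U\to\mathbb T$ ($a\in\mathcal A$) and $\mathbb U::=\omega\mid \mathbb U\sqcap\mathbb U\mid \mathbb T$; types are quotiented by commutativity, associativity and idempotence of $\sqcap$ and by $\omega\sqcap U=U$. $T$ ranges over $\mathbb T$, $U,V$ over $\mathbb U$. Environments: a type environment is a finite set $(x_i:U_i)_n$ of declarations with pairwise distinct variables; $dom$ is its set of variables; $\Gamma,x:U$ requires $x\notin dom(\Gamma)$; $env^M_\omega$ assigns $\omega$ to each variable of $FV(M)$ and nothing else; if $\Gamma_1=(x_i:U_i)_n,(y_j:V_j)_m$ and $\Gamma_2=(x_i:U'_i)_n,(z_k:W_k)_l$ with the $y_j$, $z_k$ all distinct, then $\Gamma_1\sqcap\Gamma_2=(x_i:U_i\sqcap U'_i)_n,(y_j:V_j)_m,(z_k:W_k)_l$. If $\Gamma=(x_i:U_i)_n$ and $\mathcal U=\{x_1,\dots,x_m\}$ with $m\ge n$ (so $dom(\Gamma)\subseteq\mathcal U$),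 then $\Gamma{\uparrow^{\mathcal U}}=x_1:U_1,\dots,x_n:U_n,x_{n+1}:\omega,\dots,x_m:\omega$. Subtyping: $\sqsubseteq$ (on types, on environments, and on typings $\langle\Gamma\vdash U\rangle$) is the least relation closed under: $\Phi\sqsubseteq\Phi$; transitivity; $U_1\sqcap U_2\sqsubseteq U_1$; if $U_1\sqsubseteq V_1$ and $U_2\sqsubseteq V_2$ then $U_1\sqcap U_2\sqsubseteq V_1\sqcap V_2$; if $U_2\sqsubseteq U_1$ and $T_1\sqsubseteq T_2$ then $U_1\to T_1\sqsubseteq U_2\to T_2$; if $U_1\sqsubseteq U_2$ and $x\notin dom(\Gamma)$ then $\Gamma,x:U_1\sqsubseteq\Gamma,x:U_2$; if $U_1\sqsubseteq U_2$ and $\Gamma_2\sqsubseteq\Gamma_1$ then $\langle\Gamma_1\vdash U_1\rangle\sqsubseteq\langle\Gamma_2\vdash U_2\rangle$. Typing rules for $M:\langle\Gamma\vdash U\rangle$: (ax) $x:\langle x:T\vdash T\rangle$ for $T\in\mathbb T$; ($\omega$) $M:\langle env^M_\omega\vdash\omega\rangle$; ($\to_i$) from $M:\langle\Gamma,x:U\vdash T\rangle$ infer $\lambda x.M:\langle\Gamma\vdash U\to T\rangle$; ($\to'_i$) from $M:\langle\Gamma\vdash T\rangle$ and $x\notin dom(\Gamma)$ infer $\lambda x.M:\langle\Gamma\vdash\omega\to T\rangle$; ($\to_e$) from $M_1:\langle\Gamma_1\vdash U\to T\rangle$ and $M_2:\langle\Gamma_2\vdash U\rangle$ infer $M_1M_2:\langle\Gamma_1\sqcap\Gamma_2\vdash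 T\rangle$; ($\sqcap_i$) from $M:\langle\Gamma\vdash U_1\rangle$ and $M:\langle\Gamma\vdash U_2\rangle$ infer $M:\langle\Gamma\vdash U_1\sqcap U_2\rangle$; ($\sqsubseteq$) from $M:\langle\Gamma\vdash U\rangle$ and $\langle\Gamma\vdash U\rangle\sqsubseteq\langle\Gamma'\vdash U'\rangle$ infer $M:\langle\Gamma'\vdash U'\rangle$. -}

module Defs where

open import Data.Nat using (ℕ; suc; _⊔_)
open import Data.Nat.Properties using (_≟_)
open import Data.List using (List; []; _∷_; _++_; foldr; concatMap; filter)
open import Data.List.Membership.DecPropositional _≟_ using (_∈?_)
open import Data.Maybe using (Maybe; just; nothing)
open import Data.Maybe.Relation.Binary.Pointwise using (Pointwise)
open import Data.Product using (_×_)
open import Relation.Nullary using (does; ¬?)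
open import Relation.Binary.PropositionalEquality using (_≡_)
open import Data.Bool using (if_then_else_)

-- Terms (raw named λ-terms; variables are natural numbers).
-- Everything below is invariant under α-conversion.

Var : Set
Var = ℕ

data Term : Set where
  var : Var → Term
  lam : Var → Term → Term
  app : Term → Term → Term

-- free variables (as a list; only membership matters)
fv : Term → List Var
fv (var x)   = x ∷ []
fv (lam x M) = filter (λ y → ¬? (y ≟ x)) (fv M)
fv (app M N) = fv M ++ fv N

maxList : List ℕ → ℕ
maxList = foldr _⊔_ 0

-- capture-avoiding simultaneous substitution; binders are renamed to a
-- variable fresh for the images of the free variables of the abstraction
substσ : (Var → Term) → Term → Term
substσ σ (var y)   = σ y
substσ σ (app M N) = app (substσ σ M) (substσ σ N)
substσ σ (lam y M) =
  lam z (substσ (λ w → if does (w ≟ y) then var z else σ w) M)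
  where
  z : Var
  z = suc (maxList (concatMap (λ w → fv (σ w)) (fv (lam y M))))

_[_:=_] : Term → Var → Term → Term
M [ x := N ] = substσ (λ y → if does (y ≟ x) then N else var y) M

-- Types.  𝕋 = Ty, 𝕌 = UTy.  Atomic types are natural numbers.
-- Types are raw syntax; the quotient by ACI of ⊓ and ω ⊓ U = U is
-- built into subtyping (both directions).

mutual
  data Ty : Set where
    atom : ℕ → Ty
    _⇒_  : UTy → Ty → Ty

  data UTy : Set where
    ω   : UTy
    _⊓_ : UTy → UTy → UTy
    ⌜_⌝ : Ty → UTy

infixr 7 _⇒_
infixl 8 _⊓_

data _⊑_ : UTy → UTy → Set where
  -- the quotient identifications (each in both directions)
  comm      : ∀ {U V} → (U ⊓ V) ⊑ (V ⊓ U)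
  assoc₁    : ∀ {U V W} → ((U ⊓ V) ⊓ W) ⊑ (U ⊓ (V ⊓ W))
  assoc₂    : ∀ {U V W} → (U ⊓ (V ⊓ W)) ⊑ ((U ⊓ V) ⊓ W)
  idem₁     : ∀ {U} → (U ⊓ U) ⊑ U
  idem₂     : ∀ {U} → U ⊑ (U ⊓ U)
  unit₁     : ∀ {U} → (ω ⊓ U) ⊑ U
  unit₂     : ∀ {U} → U ⊑ (ω ⊓ U)
  refl      : ∀ {U} → U ⊑ U
  trans     : ∀ {U V W} → U ⊑ V → V ⊑ W → U ⊑ W
  ⊓-left    : ∀ {U₁ U₂} → (U₁ ⊓ U₂) ⊑ U₁
  ⊓-mono    : ∀ {U₁ U₂ V₁ V₂} → U₁ ⊑ V₁ → U₂ ⊑ V₂ → (U₁ ⊓ U₂) ⊑ (V₁ ⊓ V₂)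
  ⇒-mono    : ∀ {U₁ U₂ T₁ T₂} → U₂ ⊑ U₁ → ⌜ T₁ ⌝ ⊑ ⌜ T₂ ⌝
            → ⌜ U₁ ⇒ T₁ ⌝ ⊑ ⌜ U₂ ⇒ T₂ ⌝

-- Type environments: finite partial maps Var ⇀ 𝕌 (dom = where defined).

Env : Set
Env = Var → Maybe UTy

single : Var → Ty → Env
single x T y = if does (y ≟ x) then just ⌜ T ⌝ else nothing

-- Γ , x : U   (used only when x ∉ dom Γ)
extend : Env → Var → UTy → Env
extend Γ x U y = if does (y ≟ x) then just U else Γ y

envω : Term → Env
envω M y = if does (y ∈? fv M) then just ω else nothing

_⊓ₑ_ : Env → Env → Env
(Γ₁ ⊓ₑ Γ₂) y with Γ₁ y | Γ₂ y
... | just U  | just V  = just (U ⊓ V)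
... | just U  | nothing = just U
... | nothing | just V  = just V
... | nothing | nothing = nothing

_↑_ : Env → List Var → Env
(Γ ↑ 𝒰) y with Γ y
... | just U  = just U
... | nothing = if does (y ∈? 𝒰) then just ω else nothing

_⊑ₑ_ : Env → Env → Set
Γ ⊑ₑ Γ' = ∀ y → Pointwise _⊑_ (Γ y) (Γ' y)

_⊑ₜ_ : (Env × UTy) → (Env × UTy) → Set
(Γ₁ Data.Product., U₁) ⊑ₜ (Γ₂ Data.Product., U₂) = (U₁ ⊑ U₂) × (Γ₂ ⊑ₑ Γ₁)

data _∶⟨_⊢_⟩ : Term → Env → UTy → Set where
  ax   : ∀ {x T} → var x ∶⟨ single x T ⊢ ⌜ T ⌝ ⟩
  ωr   : ∀ {M} → M ∶⟨ envω M ⊢ ω ⟩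
  →i   : ∀ {M Γ x U T} → Γ x ≡ nothing
       → M ∶⟨ extend Γ x U ⊢ ⌜ T ⌝ ⟩ → lam x M ∶⟨ Γ ⊢ ⌜ U ⇒ T ⌝ ⟩
  →i'  : ∀ {M Γ x T} → M ∶⟨ Γ ⊢ ⌜ T ⌝ ⟩ → Γ x ≡ nothing
       → lam x M ∶⟨ Γ ⊢ ⌜ ω ⇒ T ⌝ ⟩
  →e   : ∀ {M₁ M₂ Γ₁ Γ₂ U T} → M₁ ∶⟨ Γ₁ ⊢ ⌜ U ⇒ T ⌝ ⟩ → M₂ ∶⟨ Γ₂ ⊢ U ⟩
       → app M₁ M₂ ∶⟨ Γ₁ ⊓ₑ Γ₂ ⊢ ⌜ T ⌝ ⟩
  ⊓i   : ∀ {M Γ U₁ U₂} → M ∶⟨ Γ ⊢ U₁ ⟩ → M ∶⟨ Γ ⊢ U₂ ⟩ → M ∶⟨ Γ ⊢ U₁ ⊓ U₂ ⟩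
  sub  : ∀ {M Γ U Γ' U'} → M ∶⟨ Γ ⊢ U ⟩
       → (Γ Data.Product., U) ⊑ₜ (Γ' Data.Product., U') → M ∶⟨ Γ' ⊢ U' ⟩

-- The heart of the proof is a substitution inversion lemma (`invert`): a
-- typing σ(M) : ⟨Γ ⊢ U⟩ decomposes into a typing M : ⟨Θ ⊢ U⟩ together with,
-- for each declaration w : V of Θ, a typing σ w : ⟨Δ w ⊢ V⟩ such that Γ
-- bounds Δ w from below (Γ ≼ Δ w: each declaration of Δ w is matched in Γ by
-- a smaller one).  It is proved for arbitrary σ, by induction on the typing,
-- since substσ renames binders.  For σ = [x := N] it gives M a typing in
-- which x : V (or x is unused) and gives N the type V; (→i) or (→i') and
-- (→e) then type the redex in an environment E that Γ↑𝒰 bounds, and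
-- relevance (the environment of a typing declares exactly the free
-- variables of the term) upgrades this bound to Γ↑𝒰 ⊑ E.  The theorem
-- follows by induction on U, because (→e) only produces types in 𝕋.

module Submission where

open import Defs
open import Data.Nat using (suc; _≤_)
open import Data.Nat.Properties using (_≟_; m≤m⊔n; m≤n⇒m≤o⊔n; <-irrefl)
open import Data.List using (_∷_; concatMap)
open import Data.Maybe using (Maybe; just; nothing)
open import Data.Maybe.Relation.Binary.Pointwise as Pointwise using (Pointwise; just; nothing)
open import Data.Product using (Σ; _×_; _,_; proj₁; proj₂)
open import Data.Sum using (_⊎_; inj₁; inj₂)
open import Relation.Nullary using (¬_; Dec; yes; no; does; ¬?)
open import Data.Bool using (if_then_else_)
open import Data.Empty using (⊥-elim)
open import Function using (_∘_)
open import Data.List.Membership.DecPropositional _≟_ using (_∈_; _∉_; _∈?_)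
open import Data.List.Relation.Binary.Subset.Propositional using (_⊆_)
open import Data.List.Relation.Unary.Any using (here; there)
open import Data.List.Membership.Propositional.Properties using (∈-filter⁺; ∈-filter⁻; ∈-++⁺ˡ; ∈-++⁺ʳ; ∈-++⁻; ∈-concatMap⁺)
open import Data.List.Membership.Propositional using (lose)
open import Relation.Binary.PropositionalEquality using (_≡_; _≢_; refl; sym; subst; subst₂)

⊑ω : ∀ U → U ⊑ ω
⊑ω U = trans unit₂ ⊓-left

⊓-right : ∀ {U V} → (U ⊓ V) ⊑ V
⊓-right = trans comm ⊓-left

⊓-glb : ∀ {W U V} → W ⊑ U → W ⊑ V → W ⊑ (U ⊓ V)
⊓-glb p q = trans idem₂ (⊓-mono p q)

Defined : Maybe UTy → Set
Defined m = Σ UTy λ V → m ≡ just V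

nothing-undefined : ∀ {m} → m ≡ nothing → ¬ Defined m
nothing-undefined refl (_ , ())

undefined : ∀ {m} → ¬ Defined m → m ≡ nothing
undefined {just _}  m↑ = ⊥-elim (m↑ (_ , refl))
undefined {nothing} _  = refl

_⊓ₘ_ : Maybe UTy → Maybe UTy → Maybe UTy
just U  ⊓ₘ just V  = just (U ⊓ V)
just U  ⊓ₘ nothing = just U
nothing ⊓ₘ m       = m

-- _⊓ₑ_ is defined by `with`; this equation exposes its pointwise meaning
⊓ₑ-at : ∀ Γ₁ Γ₂ y → (Γ₁ ⊓ₑ Γ₂) y ≡ Γ₁ y ⊓ₘ Γ₂ y
⊓ₑ-at Γ₁ Γ₂ y with Γ₁ y | Γ₂ y
... | just _  | just _  = refl
... | just _  | nothing = refl
... | nothing | just _  = refl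
... | nothing | nothing = refl

-- `a ≼ₘ b`: every declaration in b is matched by a smaller one in a
-- (a may declare more).  This is subtyping of environments without the
-- requirement that the domains agree.
data _≼ₘ_ : Maybe UTy → Maybe UTy → Set where
  below : ∀ {W A} → W ⊑ A → just W ≼ₘ just A
  none  : ∀ {m} → m ≼ₘ nothing

≼ₘ-refl : ∀ m → m ≼ₘ m
≼ₘ-refl (just _) = below refl
≼ₘ-refl nothing  = none

≼ₘ-trans : ∀ {a b c} → a ≼ₘ b → b ≼ₘ c → a ≼ₘ c
≼ₘ-trans (below p) (below q) = below (trans p q)
≼ₘ-trans _         none      = none

≼ₘ-glb : ∀ {a b c} → a ≼ₘ b → a ≼ₘ c → a ≼ₘ (b ⊓ₘ c)
≼ₘ-glb (below p) (below q) = below (⊓-glb p q)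
≼ₘ-glb (below p) none      = below p
≼ₘ-glb none      q         = q

⊓ₘ-≼ₘˡ : ∀ a b → (a ⊓ₘ b) ≼ₘ a
⊓ₘ-≼ₘˡ (just _) (just _) = below ⊓-left
⊓ₘ-≼ₘˡ (just _) nothing  = below refl
⊓ₘ-≼ₘˡ nothing  _        = none

⊓ₘ-≼ₘʳ : ∀ a b → (a ⊓ₘ b) ≼ₘ b
⊓ₘ-≼ₘʳ (just _) (just _) = below ⊓-right
⊓ₘ-≼ₘʳ (just _) nothing  = none
⊓ₘ-≼ₘʳ nothing  b        = ≼ₘ-refl b

≼ₘ-⊓-mono : ∀ {a b c d} → a ≼ₘ b → c ≼ₘ d → (a ⊓ₘ c) ≼ₘ (b ⊓ₘ d)
≼ₘ-⊓-mono {a} {c = c} p q =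
  ≼ₘ-glb (≼ₘ-trans (⊓ₘ-≼ₘˡ a c) p) (≼ₘ-trans (⊓ₘ-≼ₘʳ a c) q)

≼ₘ-defined : ∀ {a b} → a ≼ₘ b → Defined b → Defined a
≼ₘ-defined (below _) _ = _ , refl
≼ₘ-defined none (_ , ())

⊑ₘ⇒≼ₘ : ∀ {a b} → Pointwise _⊑_ a b → a ≼ₘ b
⊑ₘ⇒≼ₘ (just p) = below p
⊑ₘ⇒≼ₘ nothing  = none

≼ₘ⇒⊑ₘ : ∀ {a b} → a ≼ₘ b → (b ≡ nothing → a ≡ nothing) → Pointwise _⊑_ a b
≼ₘ⇒⊑ₘ (below p) _ = just p
≼ₘ⇒⊑ₘ none      h rewrite h refl = nothing

⊑ₘ-defined : ∀ {a b} → Pointwise _⊑_ a b → Defined a → Defined b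
⊑ₘ-defined (just _) _ = _ , refl
⊑ₘ-defined nothing (_ , ())

⊓ₘ-defined⁻ : ∀ a b → Defined (a ⊓ₘ b) → Defined a ⊎ Defined b
⊓ₘ-defined⁻ (just _) _ _ = inj₁ (_ , refl)
⊓ₘ-defined⁻ nothing  _ h = inj₂ h

⊓ₘ-⊑ˡ : ∀ a b → (Defined b → Defined a) → Pointwise _⊑_ (a ⊓ₘ b) a
⊓ₘ-⊑ˡ (just _) (just _) _ = just ⊓-left
⊓ₘ-⊑ˡ (just _) nothing  _ = just refl
⊓ₘ-⊑ˡ nothing  nothing  _ = nothing
⊓ₘ-⊑ˡ nothing  (just _) h with h (_ , refl)
... | _ , ()

⊓ₘ-⊑ʳ : ∀ a b → (Defined a → Defined b) → Pointwise _⊑_ (a ⊓ₘ b) b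
⊓ₘ-⊑ʳ (just _) (just _) _ = just ⊓-right
⊓ₘ-⊑ʳ nothing  b        _ = Pointwise.refl refl
⊓ₘ-⊑ʳ (just _) nothing  h with h (_ , refl)
... | _ , ()

_∈dom_ : Var → Env → Set
y ∈dom Γ = Defined (Γ y)

∅ : Env
∅ _ = nothing

Empty : Env → Set
Empty E = ∀ y → E y ≡ nothing

_when_ : ∀ {P : Set} → Env → Dec P → Env
E when d = if does d then E else ∅

singleU : Var → UTy → Env
singleU w U y = if does (y ≟ w) then just U else nothing

removeE : Env → Var → Env
removeE Θ y u = if does (u ≟ y) then nothing else Θ u

-- Evaluating a conditional on a decision with known outcome.  The
-- environment operations of Defs are such conditionals; they do not reduce
-- under `with u ≟ z`, since `does (u ≟ z)` computes to a boolean test,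
-- so each is given its two defining equations below.
if-yes : ∀ {P A : Set} (d : Dec P) {a b : A} → P → (if does d then a else b) ≡ a
if-yes (yes _) _ = refl
if-yes (no ¬p) p = ⊥-elim (¬p p)

if-no : ∀ {P A : Set} (d : Dec P) {a b : A} → ¬ P → (if does d then a else b) ≡ b
if-no (yes p) ¬p = ⊥-elim (¬p p)
if-no (no _)  _  = refl

extend-self : ∀ Γ z V → extend Γ z V z ≡ just V
extend-self Γ z V = if-yes (z ≟ z) refl

extend-≢ : ∀ Γ {z u} V → u ≢ z → extend Γ z V u ≡ Γ u
extend-≢ Γ {z} {u} V u≢z = if-no (u ≟ z) u≢z

singleU-self : ∀ w U → singleU w U w ≡ just U
singleU-self w U = if-yes (w ≟ w) refl

singleU-≢ : ∀ {w y} U → y ≢ w → singleU w U y ≡ nothing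
singleU-≢ {w} {y} U y≢w = if-no (y ≟ w) y≢w

removeE-self : ∀ Θ y → removeE Θ y y ≡ nothing
removeE-self Θ y = if-yes (y ≟ y) refl

removeE-≢ : ∀ Θ {y u} → u ≢ y → removeE Θ y u ≡ Θ u
removeE-≢ Θ {y} {u} u≢y = if-no (u ≟ y) u≢y

envω-∈ : ∀ {P y} → y ∈ fv P → envω P y ≡ just ω
envω-∈ {P} {y} = if-yes (y ∈? fv P)

envω-∉ : ∀ {P y} → y ∉ fv P → envω P y ≡ nothing
envω-∉ {P} {y} = if-no (y ∈? fv P)

_≼_ : Env → Env → Set
Γ ≼ Δ = ∀ u → Γ u ≼ₘ Δ u

⊑ₑ-refl : ∀ {Γ} → Γ ⊑ₑ Γ
⊑ₑ-refl y = Pointwise.refl refl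

≼-refl : ∀ {Γ} → Γ ≼ Γ
≼-refl {Γ} u = ≼ₘ-refl (Γ u)

⊑ₑ-≼ : ∀ {Γ' Γ Δ} → Γ' ⊑ₑ Γ → Γ ≼ Δ → Γ' ≼ Δ
⊑ₑ-≼ q b u = ≼ₘ-trans (⊑ₘ⇒≼ₘ (q u)) (b u)

≼-glb : ∀ {Γ A B} → Γ ≼ A → Γ ≼ B → Γ ≼ (A ⊓ₑ B)
≼-glb {A = A} {B} p q u rewrite ⊓ₑ-at A B u = ≼ₘ-glb (p u) (q u)

≼-⊓-mono : ∀ {Γ₁ Γ₂ A B} → Γ₁ ≼ A → Γ₂ ≼ B → (Γ₁ ⊓ₑ Γ₂) ≼ (A ⊓ₑ B)
≼-⊓-mono {Γ₁} {Γ₂} {A} {B} p q u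
  rewrite ⊓ₑ-at Γ₁ Γ₂ u | ⊓ₑ-at A B u = ≼ₘ-⊓-mono (p u) (q u)

≼-when : ∀ {P : Set} {Γ E} (d : Dec P) → (P → Γ ≼ E) → Γ ≼ (E when d)
≼-when (yes p) h = h p
≼-when (no _)  h = λ _ → none

≼-unextend : ∀ {Γ z V E} → extend Γ z V ≼ E → ¬ z ∈dom E → Γ ≼ E
≼-unextend {Γ} {z} {V} {E} b z∉E u with u ≟ z
... | yes refl rewrite undefined z∉E = none
... | no u≢z   = subst (_≼ₘ E u) (extend-≢ Γ V u≢z) (b u)

⊓ₑ-⊑ₑˡ : ∀ {A B} → (∀ {y} → y ∈dom B → y ∈dom A) → (A ⊓ₑ B) ⊑ₑ A
⊓ₑ-⊑ₑˡ {A} {B} h y rewrite ⊓ₑ-at A B y = ⊓ₘ-⊑ˡ (A y) (B y) h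

⊓ₑ-⊑ₑʳ : ∀ {A B} → (∀ {y} → y ∈dom A → y ∈dom B) → (A ⊓ₑ B) ⊑ₑ B
⊓ₑ-⊑ₑʳ {A} {B} h y rewrite ⊓ₑ-at A B y = ⊓ₘ-⊑ʳ (A y) (B y) h

⊓ₑ-empty : ∀ {A B} → Empty A → Empty B → Empty (A ⊓ₑ B)
⊓ₑ-empty {A} {B} a b y rewrite ⊓ₑ-at A B y | a y | b y = refl

extend-removeE : ∀ {Θ y V} → Θ y ≡ just V → extend (removeE Θ y) y V ⊑ₑ Θ
extend-removeE {Θ} {y} {V} eq u with u ≟ y
... | yes refl rewrite extend-self (removeE Θ u) u V | eq = just refl
... | no u≢y   rewrite extend-≢ (removeE Θ y) V u≢y | removeE-≢ Θ u≢y = Pointwise.refl refl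

removeE-unused : ∀ {Θ y} → Θ y ≡ nothing → removeE Θ y ⊑ₑ Θ
removeE-unused {Θ} {y} eq u with u ≟ y
... | yes refl rewrite removeE-self Θ u | eq = nothing
... | no u≢y   rewrite removeE-≢ Θ u≢y = Pointwise.refl refl

↑-≼ : ∀ {Γ L E} → Γ ≼ E → (Γ ↑ L) ≼ E
↑-≼ {Γ} {L} {E} b u with Γ u | E u | b u
... | just _  | _ | bu = bu
... | nothing | _ | none = none

↑-≼-envω : ∀ {Γ L P} → fv P ⊆ L → (Γ ↑ L) ≼ envω P
↑-≼-envω {Γ} {L} {P} fvP⊆L u with u ∈? fv P
... | no _ = none
... | yes u∈P with Γ u
...   | just W  = below (⊑ω W)
...   | nothing = subst (_≼ₘ just ω) (sym (if-yes (u ∈? L) (fvP⊆L u∈P))) (below refl)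

↑-undeclared : ∀ {Γ L y} → ¬ y ∈dom Γ → y ∉ L → (Γ ↑ L) y ≡ nothing
↑-undeclared {Γ} {L} {y} y∉Γ y∉L with Γ y | undefined y∉Γ
... | nothing | refl = if-no (y ∈? L) y∉L

↑-⊑ₑ : ∀ {Γ L E} → (Γ ↑ L) ≼ E → (∀ {y} → y ∈dom Γ → y ∈ L) → (∀ {y} → y ∈ L → y ∈dom E)
     → (Γ ↑ L) ⊑ₑ E
↑-⊑ₑ {Γ} {L} {E} b domΓ⊆L L⊆domE y = ≼ₘ⇒⊑ₘ (b y) undeclared
  where
  undeclared : E y ≡ nothing → (Γ ↑ L) y ≡ nothing
  undeclared Ey≡nothing = ↑-undeclared {Γ} (λ y∈Γ → y∉L (domΓ⊆L y∈Γ)) y∉L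
    where
    y∉L : y ∉ L
    y∉L y∈L = nothing-undefined Ey≡nothing (L⊆domE y∈L)

∈-lam⁻ : ∀ {x y M} → y ∈ fv (lam x M) → y ∈ fv M × y ≢ x
∈-lam⁻ {x} = ∈-filter⁻ (λ u → ¬? (u ≟ x))

∈-lam⁺ : ∀ {x y M} → y ∈ fv M → y ≢ x → y ∈ fv (lam x M)
∈-lam⁺ {x} = ∈-filter⁺ (λ u → ¬? (u ≟ x))

subE : ∀ {M Γ Γ' U} → M ∶⟨ Γ ⊢ U ⟩ → Γ' ⊑ₑ Γ → M ∶⟨ Γ' ⊢ U ⟩
subE d p = sub d (refl , p)

subT : ∀ {M Γ U U'} → M ∶⟨ Γ ⊢ U ⟩ → U ⊑ U' → M ∶⟨ Γ ⊢ U' ⟩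
subT d p = sub d (p , ⊑ₑ-refl)

fv⊆dom : ∀ {M Γ U} → M ∶⟨ Γ ⊢ U ⟩ → ∀ {y} → y ∈ fv M → y ∈dom Γ
fv⊆dom (ax {x} {T}) (here refl) = ⌜ T ⌝ , singleU-self x ⌜ T ⌝
fv⊆dom (ωr {M}) y∈M = ω , envω-∈ {M} y∈M
fv⊆dom (→i {M} {Γ} {x} {U} _ d) y∈λ =
  let (y∈M , y≢x) = ∈-lam⁻ {x} {M = M} y∈λ in subst Defined (extend-≢ Γ U y≢x) (fv⊆dom d y∈M)
fv⊆dom (→i' {M} {x = x} d _) y∈λ = fv⊆dom d (proj₁ (∈-lam⁻ {x} {M = M} y∈λ))
fv⊆dom (→e {M₁} {M₂} {Γ₁} {Γ₂} d₁ d₂) {y} y∈M₁M₂ =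
  subst Defined (sym (⊓ₑ-at Γ₁ Γ₂ y)) (side (∈-++⁻ (fv M₁) y∈M₁M₂))
  where
  side : y ∈ fv M₁ ⊎ y ∈ fv M₂ → Defined (Γ₁ y ⊓ₘ Γ₂ y)
  side (inj₁ y∈M₁) = ≼ₘ-defined (⊓ₘ-≼ₘˡ (Γ₁ y) (Γ₂ y)) (fv⊆dom d₁ y∈M₁)
  side (inj₂ y∈M₂) = ≼ₘ-defined (⊓ₘ-≼ₘʳ (Γ₁ y) (Γ₂ y)) (fv⊆dom d₂ y∈M₂)
fv⊆dom (⊓i d _) y∈M = fv⊆dom d y∈M
fv⊆dom (sub d (_ , q)) {y} y∈M = ≼ₘ-defined (⊑ₘ⇒≼ₘ (q y)) (fv⊆dom d y∈M)

dom⊆fv : ∀ {M Γ U} → M ∶⟨ Γ ⊢ U ⟩ → ∀ {y} → y ∈dom Γ → y ∈ fv M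
dom⊆fv (ax {x} {T}) {y} y∈Γ with y ≟ x
... | yes y≡x = here y≡x
... | no y≢x  = ⊥-elim (nothing-undefined (singleU-≢ ⌜ T ⌝ y≢x) y∈Γ)
dom⊆fv (ωr {M}) {y} y∈Γ with y ∈? fv M
... | yes y∈M = y∈M
... | no _    = ⊥-elim (nothing-undefined refl y∈Γ)
dom⊆fv (→i {M} {Γ} {x} {U} Γx d) {y} y∈Γ =
  ∈-lam⁺ {x} {M = M} (dom⊆fv d (subst Defined (sym (extend-≢ Γ U y≢x)) y∈Γ)) y≢x
  where
  y≢x : y ≢ x
  y≢x refl = nothing-undefined Γx y∈Γ
dom⊆fv (→i' {M} {x = x} d Γx) {y} y∈Γ = ∈-lam⁺ {x} {M = M} (dom⊆fv d y∈Γ) y≢x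
  where
  y≢x : y ≢ x
  y≢x refl = nothing-undefined Γx y∈Γ
dom⊆fv (→e {M₁} {Γ₁ = Γ₁} {Γ₂} d₁ d₂) {y} y∈Γ
  with ⊓ₘ-defined⁻ (Γ₁ y) (Γ₂ y) (subst Defined (⊓ₑ-at Γ₁ Γ₂ y) y∈Γ)
... | inj₁ y∈Γ₁ = ∈-++⁺ˡ (dom⊆fv d₁ y∈Γ₁)
... | inj₂ y∈Γ₂ = ∈-++⁺ʳ (fv M₁) (dom⊆fv d₂ y∈Γ₂)
dom⊆fv (⊓i d _) y∈Γ = dom⊆fv d y∈Γ
dom⊆fv (sub d (_ , q)) {y} y∈Γ = dom⊆fv d (⊑ₘ-defined (q y) y∈Γ)

singleU-⊑ₑ : ∀ {w U U'} → U ⊑ U' → singleU w U ⊑ₑ singleU w U'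
singleU-⊑ₑ {w} {U} {U'} p y with y ≟ w
... | yes refl rewrite singleU-self y U | singleU-self y U' = just p
... | no y≢w   rewrite singleU-≢ U y≢w | singleU-≢ U' y≢w = nothing

var-typing : ∀ w U → var w ∶⟨ singleU w U ⊢ U ⟩
var-typing w ω = subE ωr singleU-⊑ₑ-envω
  where
  singleU-⊑ₑ-envω : singleU w ω ⊑ₑ envω (var w)
  singleU-⊑ₑ-envω y with y ≟ w
  ... | yes refl rewrite singleU-self y ω | envω-∈ {var y} (here refl) = just refl
  ... | no y≢w   rewrite singleU-≢ ω y≢w | envω-∉ {var w} (λ { (here y≡w) → y≢w y≡w }) = nothing
var-typing w (U₁ ⊓ U₂) =
  ⊓i (subE (var-typing w U₁) (singleU-⊑ₑ ⊓-left)) (subE (var-typing w U₂) (singleU-⊑ₑ ⊓-right))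
var-typing w ⌜ T ⌝ = ax

var-inversion : ∀ {w Γ U} → var w ∶⟨ Γ ⊢ U ⟩ → Γ w ≼ₘ just U
var-inversion (ax {w} {T}) = subst (_≼ₘ just ⌜ T ⌝) (sym (singleU-self w ⌜ T ⌝)) (below refl)
var-inversion (ωr {var w}) = subst (_≼ₘ just ω) (sym (envω-∈ {var w} (here refl))) (below refl)
var-inversion (⊓i d₁ d₂) = ≼ₘ-glb (var-inversion d₁) (var-inversion d₂)
var-inversion {w} (sub d (p , q)) = ≼ₘ-trans (⊑ₘ⇒≼ₘ (q w)) (≼ₘ-trans (var-inversion d) (below p))

-- Two typings of the same term combine into a typing by the meet.
-- (Both environments have domain fv M, by relevance.)
combine : ∀ {M A B U₁ U₂} → M ∶⟨ A ⊢ U₁ ⟩ → M ∶⟨ B ⊢ U₂ ⟩ → M ∶⟨ A ⊓ₑ B ⊢ U₁ ⊓ U₂ ⟩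
combine d₁ d₂ = ⊓i (subE d₁ (⊓ₑ-⊑ₑˡ (fv⊆dom d₁ ∘ dom⊆fv d₂)))
                   (subE d₂ (⊓ₑ-⊑ₑʳ (fv⊆dom d₂ ∘ dom⊆fv d₁)))

abstract-used : ∀ {M Θ y V T} → Θ y ≡ just V → M ∶⟨ Θ ⊢ ⌜ T ⌝ ⟩
              → lam y M ∶⟨ removeE Θ y ⊢ ⌜ V ⇒ T ⌝ ⟩
abstract-used {Θ = Θ} {y} Θy d = →i (removeE-self Θ y) (subE d (extend-removeE Θy))

abstract-unused : ∀ {M Θ y T} → Θ y ≡ nothing → M ∶⟨ Θ ⊢ ⌜ T ⌝ ⟩
                → lam y M ∶⟨ removeE Θ y ⊢ ⌜ ω ⇒ T ⌝ ⟩
abstract-unused {Θ = Θ} {y} Θy d = →i' (subE d (removeE-unused Θy)) (removeE-self Θ y)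

data _∶?⟨_⊢_⟩ (P : Term) (E : Env) : Maybe UTy → Set where
  typed   : ∀ {V} → P ∶⟨ E ⊢ V ⟩ → P ∶?⟨ E ⊢ just V ⟩
  untyped : Empty E → P ∶?⟨ E ⊢ nothing ⟩

∶?-meet : ∀ {P E₁ E₂ m₁ m₂} → P ∶?⟨ E₁ ⊢ m₁ ⟩ → P ∶?⟨ E₂ ⊢ m₂ ⟩ → P ∶?⟨ E₁ ⊓ₑ E₂ ⊢ m₁ ⊓ₘ m₂ ⟩
∶?-meet (typed d₁)   (typed d₂)   = typed (combine d₁ d₂)
∶?-meet (typed d₁)   (untyped e₂) =
  typed (subE d₁ (⊓ₑ-⊑ₑˡ (λ y∈E₂ → ⊥-elim (nothing-undefined (e₂ _) y∈E₂))))
∶?-meet (untyped e₁) (typed d₂)   =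
  typed (subE d₂ (⊓ₑ-⊑ₑʳ (λ y∈E₁ → ⊥-elim (nothing-undefined (e₁ _) y∈E₁))))
∶?-meet (untyped e₁) (untyped e₂) = untyped (⊓ₑ-empty e₁ e₂)

∶?-declared : ∀ {P E m u} → P ∶?⟨ E ⊢ m ⟩ → u ∈dom E → Defined m × u ∈ fv P
∶?-declared (typed d)   u∈E = (_ , refl) , dom⊆fv d u∈E
∶?-declared (untyped e) u∈E = ⊥-elim (nothing-undefined (e _) u∈E)

-- Under a binder y, substσ
-- renames y to the variable z = fresh σ y M and updates σ by y ↦ z; the
-- two definitions below are definitionally those used by substσ.

fresh : (Var → Term) → Var → Term → Var
fresh σ y M = suc (maxList (concatMap (λ w → fv (σ w)) (fv (lam y M))))

upd : (Var → Term) → Var → Var → Var → Term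
upd σ y z w = if does (w ≟ y) then var z else σ w

upd-self : ∀ σ y z → upd σ y z y ≡ var z
upd-self σ y z = if-yes (y ≟ y) refl

upd-≢ : ∀ σ {y} z {w} → w ≢ y → upd σ y z w ≡ σ w
upd-≢ σ {y} z {w} = if-no (w ≟ y)

maxList-≤ : ∀ {v} L → v ∈ L → v ≤ maxList L
maxList-≤ (a ∷ L) (here refl) = m≤m⊔n a (maxList L)
maxList-≤ (a ∷ L) (there v∈L) = m≤n⇒m≤o⊔n a (maxList-≤ L v∈L)

fresh-≢ : ∀ σ y M {w v} → w ∈ fv (lam y M) → v ∈ fv (σ w) → v ≢ fresh σ y M
fresh-≢ σ y M w∈ v∈ v≡fresh = <-irrefl refl (subst (_≤ maxList images) v≡fresh v≤max)
  where
  images = concatMap (λ w → fv (σ w)) (fv (lam y M))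
  v≤max = maxList-≤ images (∈-concatMap⁺ (λ w → fv (σ w)) (lose w∈ v∈))

fv-substσ⁺ : ∀ σ M {w y} → w ∈ fv M → y ∈ fv (σ w) → y ∈ fv (substσ σ M)
fv-substσ⁺ σ (var x) (here refl) y∈ = y∈
fv-substσ⁺ σ (app M N) w∈ y∈ with ∈-++⁻ (fv M) w∈
... | inj₁ w∈M = ∈-++⁺ˡ (fv-substσ⁺ σ M w∈M y∈)
... | inj₂ w∈N = ∈-++⁺ʳ (fv (substσ σ M)) (fv-substσ⁺ σ N w∈N y∈)
fv-substσ⁺ σ (lam x M) {w} {y} w∈ y∈ =
  ∈-lam⁺ {M = substσ (upd σ x z) M}
         (fv-substσ⁺ (upd σ x z) M w∈M (subst (λ t → y ∈ fv t) (sym (upd-≢ σ z w≢x)) y∈))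
         (fresh-≢ σ x M w∈ y∈)
  where
  z = fresh σ x M
  w∈M = proj₁ (∈-lam⁻ {x} {M = M} w∈)
  w≢x = proj₂ (∈-lam⁻ {x} {M = M} w∈)

fv-substσ⁻ : ∀ σ M {y} → y ∈ fv (substσ σ M) → Σ Var λ w → w ∈ fv M × y ∈ fv (σ w)
fv-substσ⁻ σ (var x) y∈ = x , here refl , y∈
fv-substσ⁻ σ (app M N) y∈ with ∈-++⁻ (fv (substσ σ M)) y∈
... | inj₁ y∈M = let (w , w∈ , y∈w) = fv-substσ⁻ σ M y∈M in w , ∈-++⁺ˡ w∈ , y∈w
... | inj₂ y∈N = let (w , w∈ , y∈w) = fv-substσ⁻ σ N y∈N in w , ∈-++⁺ʳ (fv M) w∈ , y∈w
fv-substσ⁻ σ (lam x M) {y} y∈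
  with ∈-lam⁻ {fresh σ x M} {M = substσ (upd σ x (fresh σ x M)) M} y∈
... | y∈body , y≢z with fv-substσ⁻ (upd σ x (fresh σ x M)) M y∈body
... | w , w∈M , y∈w with w ≟ x
... | yes refl = ⊥-elim (y≢z (y∈var (subst (λ t → y ∈ fv t) (upd-self σ w (fresh σ w M)) y∈w)))
  where
  y∈var : ∀ {u} → y ∈ fv (var u) → y ≡ u
  y∈var (here y≡u) = y≡u
... | no w≢x =
  w , ∈-lam⁺ {x} {M = M} w∈M w≢x , subst (λ t → y ∈ fv t) (upd-≢ σ (fresh σ x M) w≢x) y∈w

record Inversion (σ : Var → Term) (M : Term) (Γ : Env) (U : UTy) : Set where
  constructor inversion
  field
    Θ      : Env
    Δ      : Var → Env
    typing : M ∶⟨ Θ ⊢ U ⟩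
    images : ∀ w → σ w ∶?⟨ Δ w ⊢ Θ w ⟩
    bounds : ∀ w → Γ ≼ Δ w

renaming-bound : ∀ {σ M Γ U w u} (inv : Inversion σ M Γ U) → σ w ≡ var u
               → Γ u ≼ₘ Inversion.Θ inv w
renaming-bound {w = w} {u} (inversion Θ Δ _ images bounds) σw≡u with Θ w | images w
... | nothing | _       = none
... | just V  | typed d = ≼ₘ-trans (bounds w u) (var-inversion (subst (_∶⟨ Δ w ⊢ V ⟩) σw≡u d))

fresh-undeclared : ∀ {σ y M Γ U w} (inv : Inversion (upd σ y (fresh σ y M)) M Γ U)
                 → w ≢ y → ¬ fresh σ y M ∈dom Inversion.Δ inv w
fresh-undeclared {σ} {y} {M} {w = w} (inversion Θ Δ typing images _) w≢y z∈Δw =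
  fresh-≢ σ y M (∈-lam⁺ {y} {M = M} (dom⊆fv typing w∈Θ) w≢y)
         (subst (λ t → _ ∈ fv t) (upd-≢ σ _ w≢y) z∈image) refl
  where
  w∈Θ = proj₁ (∶?-declared (images w) z∈Δw)
  z∈image = proj₂ (∶?-declared (images w) z∈Δw)

invert-var : ∀ {σ w Γ U} → σ w ∶⟨ Γ ⊢ U ⟩ → Inversion σ (var w) Γ U
invert-var {σ} {w} {Γ} {U} d =
  inversion (singleU w U) (λ w' → Γ when (w' ≟ w)) (var-typing w U) images
            (λ w' → ≼-when (w' ≟ w) (λ _ → ≼-refl))
  where
  images : ∀ w' → σ w' ∶?⟨ Γ when (w' ≟ w) ⊢ singleU w U w' ⟩
  images w' with w' ≟ w
  ... | yes refl = subst₂ (σ w ∶?⟨_⊢_⟩) (sym (if-yes (w ≟ w) refl)) (sym (singleU-self w U)) (typed d)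
  ... | no w'≢w  = subst₂ (σ w' ∶?⟨_⊢_⟩) (sym (if-no (w' ≟ w) w'≢w)) (sym (singleU-≢ U w'≢w))
                          (untyped (λ _ → refl))

envω-≼ : ∀ {P Q} → fv P ⊆ fv Q → envω Q ≼ envω P
envω-≼ {P} {Q} fvP⊆fvQ u with u ∈? fv P
... | no _    = none
... | yes u∈P = subst (_≼ₘ just ω) (sym (envω-∈ {Q} (fvP⊆fvQ u∈P))) (below refl)

invert-ω : ∀ σ M → Inversion σ M (envω (substσ σ M)) ω
invert-ω σ M =
  inversion (envω M) (λ w → envω (σ w) when (w ∈? fv M)) ωr images
            (λ w → ≼-when (w ∈? fv M) (λ w∈M → envω-≼ {σ w} {substσ σ M} (fv-substσ⁺ σ M w∈M)))
  where
  images : ∀ w → σ w ∶?⟨ envω (σ w) when (w ∈? fv M) ⊢ envω M w ⟩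
  images w with w ∈? fv M
  ... | yes _ = typed ωr
  ... | no _  = untyped (λ _ → refl)

meet-images : ∀ {σ : Var → Term} {Θ₁ Θ₂ : Env} {Δ₁ Δ₂ : Var → Env}
            → (∀ w → σ w ∶?⟨ Δ₁ w ⊢ Θ₁ w ⟩) → (∀ w → σ w ∶?⟨ Δ₂ w ⊢ Θ₂ w ⟩)
            → ∀ w → σ w ∶?⟨ Δ₁ w ⊓ₑ Δ₂ w ⊢ (Θ₁ ⊓ₑ Θ₂) w ⟩
meet-images {σ} {Θ₁} {Θ₂} {Δ₁} {Δ₂} images₁ images₂ w =
  subst (λ m → σ w ∶?⟨ Δ₁ w ⊓ₑ Δ₂ w ⊢ m ⟩) (sym (⊓ₑ-at Θ₁ Θ₂ w)) (∶?-meet (images₁ w) (images₂ w))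

invert-meet : ∀ {σ M Γ U₁ U₂} → Inversion σ M Γ U₁ → Inversion σ M Γ U₂ → Inversion σ M Γ (U₁ ⊓ U₂)
invert-meet (inversion Θ₁ Δ₁ typing₁ images₁ bounds₁) (inversion Θ₂ Δ₂ typing₂ images₂ bounds₂) =
  inversion (Θ₁ ⊓ₑ Θ₂) (λ w → Δ₁ w ⊓ₑ Δ₂ w) (combine typing₁ typing₂)
            (meet-images {Θ₁ = Θ₁} {Θ₂} {Δ₁} {Δ₂} images₁ images₂)
            (λ w → ≼-glb (bounds₁ w) (bounds₂ w))

invert-app : ∀ {σ M₁ M₂ Γ₁ Γ₂ U T} → Inversion σ M₁ Γ₁ ⌜ U ⇒ T ⌝ → Inversion σ M₂ Γ₂ U
           → Inversion σ (app M₁ M₂) (Γ₁ ⊓ₑ Γ₂) ⌜ T ⌝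
invert-app (inversion Θ₁ Δ₁ typing₁ images₁ bounds₁) (inversion Θ₂ Δ₂ typing₂ images₂ bounds₂) =
  inversion (Θ₁ ⊓ₑ Θ₂) (λ w → Δ₁ w ⊓ₑ Δ₂ w) (→e typing₁ typing₂)
            (meet-images {Θ₁ = Θ₁} {Θ₂} {Δ₁} {Δ₂} images₁ images₂)
            (λ w → ≼-⊓-mono (bounds₁ w) (bounds₂ w))

invert-sub : ∀ {σ M Γ U Γ' U'} → Inversion σ M Γ U → (Γ , U) ⊑ₜ (Γ' , U') → Inversion σ M Γ' U'
invert-sub (inversion Θ Δ typing images bounds) (U⊑U' , Γ'⊑Γ) =
  inversion Θ Δ (subT typing U⊑U') images (λ w → ⊑ₑ-≼ Γ'⊑Γ (bounds w))

forget-images : ∀ {σ : Var → Term} {y z} {Θ : Env} {Δ : Var → Env}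
              → (∀ w → upd σ y z w ∶?⟨ Δ w ⊢ Θ w ⟩)
              → ∀ w → σ w ∶?⟨ Δ w when ¬? (w ≟ y) ⊢ removeE Θ y w ⟩
forget-images {σ} {y} {z} {Θ} {Δ} images w with w ≟ y
... | yes refl = subst₂ (σ w ∶?⟨_⊢_⟩) (sym (if-no (¬? (w ≟ w)) (λ w≢w → w≢w refl))) (sym (removeE-self Θ w))
                        (untyped (λ _ → refl))
... | no w≢y   = subst₂ (σ w ∶?⟨_⊢_⟩) (sym (if-yes (¬? (w ≟ y)) w≢y)) (sym (removeE-≢ Θ w≢y))
                        (subst (λ t → t ∶?⟨ Δ w ⊢ Θ w ⟩) (upd-≢ σ z w≢y) (images w))

invert-abs : ∀ {σ y M Γ V T} → Inversion (upd σ y (fresh σ y M)) M (extend Γ (fresh σ y M) V) ⌜ T ⌝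
           → Inversion σ (lam y M) Γ ⌜ V ⇒ T ⌝
invert-abs {σ} {y} {M} {Γ} {V} {T} inv@(inversion Θ Δ body images bounds) =
  inversion (removeE Θ y) (λ w → Δ w when ¬? (w ≟ y)) typing (forget-images images)
            (λ w → ≼-when (¬? (w ≟ y)) (λ w≢y → ≼-unextend (bounds w) (fresh-undeclared inv w≢y)))
  where
  z = fresh σ y M
  -- the binder's type V is below the type of y in Θ, as z : V renames y
  typing : lam y M ∶⟨ removeE Θ y ⊢ ⌜ V ⇒ T ⌝ ⟩
  typing with Θ y in Θy | renaming-bound inv (upd-self σ y z)
  ... | nothing | _  = subT (abstract-unused Θy body) (⇒-mono (⊑ω V) refl)
  ... | just Vy | bz with subst (_≼ₘ just Vy) (extend-self Γ z V) bz
  ...   | below V⊑Vy = subT (abstract-used Θy body) (⇒-mono V⊑Vy refl)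

invert-abs' : ∀ {σ y M Γ T} → Γ (fresh σ y M) ≡ nothing
            → Inversion (upd σ y (fresh σ y M)) M Γ ⌜ T ⌝ → Inversion σ (lam y M) Γ ⌜ ω ⇒ T ⌝
invert-abs' {σ} {y} {M} {Γ} {T} Γz inv@(inversion Θ Δ body images bounds) =
  inversion (removeE Θ y) (λ w → Δ w when ¬? (w ≟ y)) typing (forget-images images)
            (λ w → ≼-when (¬? (w ≟ y)) (λ _ → bounds w))
  where
  -- y cannot be used in M: it is renamed to z, which Γ does not declare
  typing : lam y M ∶⟨ removeE Θ y ⊢ ⌜ ω ⇒ T ⌝ ⟩
  typing with Θ y in Θy | renaming-bound inv (upd-self σ y (fresh σ y M))
  ... | nothing | _  = abstract-unused Θy body
  ... | just _  | bz = ⊥-elim (nothing-undefined Γz (≼ₘ-defined bz (_ , refl)))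

invert : ∀ {P Γ U} → P ∶⟨ Γ ⊢ U ⟩ → ∀ σ M → P ≡ substσ σ M → Inversion σ M Γ U
invert d           σ (var w)     refl = invert-var d
invert ωr          σ M           refl = invert-ω σ M
invert (→i _ d)    σ (lam y M)   refl = invert-abs (invert d _ M refl)
invert (→i' d Γz)  σ (lam y M)   refl = invert-abs' Γz (invert d _ M refl)
invert (→e d₁ d₂)  σ (app M₁ M₂) refl = invert-app (invert d₁ σ M₁ refl) (invert d₂ σ M₂ refl)
invert (⊓i d₁ d₂)  σ M           eq   = invert-meet (invert d₁ σ M eq) (invert d₂ σ M eq)
invert (sub d s)   σ M           eq   = invert-sub (invert d σ M eq) s
invert ax          σ (lam _ _)   ()
invert ax          σ (app _ _)   ()
invert (→i _ _)    σ (app _ _)   ()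
invert (→i' _ _)   σ (app _ _)   ()
invert (→e _ _)    σ (lam _ _)   ()

_↦_ : Var → Term → Var → Term
(x ↦ N) y = if does (y ≟ x) then N else var y

↦-self : ∀ x N → (x ↦ N) x ≡ N
↦-self x N = if-yes (x ≟ x) refl

↦-≢ : ∀ {x y} N → y ≢ x → (x ↦ N) y ≡ var y
↦-≢ {x} {y} N = if-no (y ≟ x)

fv-subst⊆ : ∀ M N x → fv (M [ x := N ]) ⊆ fv (app (lam x M) N)
fv-subst⊆ M N x {y} y∈ with fv-substσ⁻ (x ↦ N) M y∈
... | w , w∈M , y∈w with w ≟ x
...   | yes refl = ∈-++⁺ʳ (fv (lam w M)) (subst (λ t → y ∈ fv t) (↦-self w N) y∈w)
...   | no w≢x with subst (λ t → y ∈ fv t) (↦-≢ N w≢x) y∈w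
...     | here refl = ∈-++⁺ˡ (∈-lam⁺ {x} {M = M} w∈M w≢x)

-- Variables other than x are fixed by [x := N], so Γ bounds Θ away from x.
unsubstituted-bound : ∀ {M N x Γ U} (inv : Inversion (x ↦ N) M Γ U)
                    → Γ ≼ removeE (Inversion.Θ inv) x
unsubstituted-bound {N = N} {x} inv u with u ≟ x
... | yes refl = subst (_ ≼ₘ_) (sym (removeE-self (Inversion.Θ inv) u)) none
... | no u≢x   =
  subst (_ ≼ₘ_) (sym (removeE-≢ (Inversion.Θ inv) u≢x)) (renaming-bound inv (↦-≢ N u≢x))

-- The body gets the typing from
-- the inversion, the argument N the type of x in it (or ω if x is unused).
expand-arrow : ∀ {M N x Γ T} → (M [ x := N ]) ∶⟨ Γ ⊢ ⌜ T ⌝ ⟩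
             → Σ Env λ E → app (lam x M) N ∶⟨ E ⊢ ⌜ T ⌝ ⟩ × (Γ ↑ fv (app (lam x M) N)) ≼ E
expand-arrow {M} {N} {x} d = redex-typing (invert d (x ↦ N) M refl)
  where
  redex-typing : ∀ {Γ T} → Inversion (x ↦ N) M Γ ⌜ T ⌝
               → Σ Env λ E → app (lam x M) N ∶⟨ E ⊢ ⌜ T ⌝ ⟩ × (Γ ↑ fv (app (lam x M) N)) ≼ E
  redex-typing {Γ} inv@(inversion Θ Δ body images bounds)
    with Θ x in Θx | subst (λ t → t ∶?⟨ Δ x ⊢ Θ x ⟩) (↦-self x N) (images x)
  ... | just V  | typed argument =
    removeE Θ x ⊓ₑ Δ x , →e (abstract-used Θx body) argument ,
    ≼-glb (↑-≼ (unsubstituted-bound inv)) (↑-≼ (bounds x))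
  ... | nothing | _ =
    removeE Θ x ⊓ₑ envω N , →e (abstract-unused Θx body) ωr ,
    ≼-glb (↑-≼ (unsubstituted-bound inv)) (↑-≼-envω {Γ} {P = N} (∈-++⁺ʳ (fv (lam x M))))

retype-redex : ∀ {M N x Γ U E V} → (M [ x := N ]) ∶⟨ Γ ⊢ U ⟩ → app (lam x M) N ∶⟨ E ⊢ V ⟩
             → (Γ ↑ fv (app (lam x M) N)) ≼ E → app (lam x M) N ∶⟨ Γ ↑ fv (app (lam x M) N) ⊢ V ⟩
retype-redex {M} {N} {x} d redex bound =
  subE redex (↑-⊑ₑ bound (λ y∈Γ → fv-subst⊆ M N x (dom⊆fv d y∈Γ)) (fv⊆dom redex))

-- Lemma 3.10.  By induction on U: ω is handled by (ω), meets by (⊓i), and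
-- arrow types by expand-arrow.
lemma3p10 : ∀ (M N : Term) (x : Var) (Γ : Env) (U : UTy)
          → (M [ x := N ]) ∶⟨ Γ ⊢ U ⟩
          → x ∉ fv N
          → app (lam x M) N ∶⟨ Γ ↑ fv (app (lam x M) N) ⊢ U ⟩
lemma3p10 M N x Γ ω d _ = retype-redex d ωr (↑-≼-envω {Γ} {P = app (lam x M) N} (λ y∈ → y∈))
lemma3p10 M N x Γ (U₁ ⊓ U₂) d x∉N =
  ⊓i (lemma3p10 M N x Γ U₁ (subT d ⊓-left) x∉N) (lemma3p10 M N x Γ U₂ (subT d ⊓-right) x∉N)
lemma3p10 M N x Γ ⌜ T ⌝ d _ =
  let (E , redex , bound) = expand-arrow d in retype-redex d redex bound
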